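{- Let $G$ be a finite simple graph and $k$ a positive integer. If $G$ has a redundant identifying code of cardinality at most $k$ (i.e. $\mathrm{RED{:}IC}(G) \le k$), then $|V(G)| \le 2^{k-1} - 1$.
   Context: $N[v]$ denotes the closed neighborhood of $v$ and $\Delta$ symmetric difference. A set $S \subseteq V(G)$ is a redundant identifying code if every vertex $v$ satisfies $|N[v] \cap S| \ge 2$ and every pair of distinct vertices $u,v$ satisfies $|(N[u]\cap S)\,\Delta\,(N[v]\cap S)| \ge 2$. $\mathrm{RED{:}IC}(G)$ is the minimum cardinality of such a set. -}

module Defs where

open import Data.Nat using (ℕ; _≤_)
open import Data.Bool using (Bool; true; false; _∨_; _xor_)
open import Data.Fin using (Fin; _≟_)
open import Data.Fin.Subset using (Subset; _∩_; ∣_∣)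
open import Data.Vec using (tabulate; zipWith)
open import Relation.Nullary.Decidable using (⌊_⌋)
open import Relation.Binary.PropositionalEquality using (_≡_)
open import Relation.Nullary using (¬_)
open import Data.Product using (_×_; ∃-syntax)

record SimpleGraph (n : ℕ) : Set where
  field
    adj       : Fin n → Fin n → Bool
    adj-sym   : ∀ u v → adj u v ≡ adj v u
    adj-irrefl : ∀ v → adj v v ≡ false
open SimpleGraph public

N[_]_ : ∀ {n} → Fin n → SimpleGraph n → Subset n
N[ v ] G = tabulate (λ u → ⌊ u ≟ v ⌋ ∨ adj G v u)

_Δ_ : ∀ {n} → Subset n → Subset n → Subset n
A Δ B = zipWith _xor_ A B

IsRedIC : ∀ {n} → SimpleGraph n → Subset n → Set
IsRedIC {n} G S =
  (∀ (v : Fin n) → 2 ≤ ∣ (N[ v ] G) ∩ S ∣) ×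
  (∀ (u v : Fin n) → ¬ (u ≡ v) → 2 ≤ ∣ ((N[ u ] G) ∩ S) Δ ((N[ v ] G) ∩ S) ∣)


HasRedICAtMost : ∀ {n} → SimpleGraph n → ℕ → Set
HasRedICAtMost G k = ∃[ S ] (IsRedIC G S × ∣ S ∣ ≤ k)

{-# OPTIONS --safe #-}
-- Let S be a redundant identifying code. Each vertex v is determined by its
-- trace N[v] ∩ S, read as a subset of S. Deleting one fixed element of S from
-- every trace keeps the traces pairwise distinct, since distinct traces differ
-- in at least two elements, and nonempty, since every trace has at least two
-- elements. Hence n is at most the number 2 ^ (∣ S ∣ - 1) - 1 of nonempty
-- subsets of an (∣ S ∣ - 1)-element set.
module Submission where

open import Defs
open import Data.Nat using (ℕ; zero; suc; _≤_; _∸_; _^_; z≤n; s≤s)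
open import Data.Nat.Properties using (≤-trans; ≤-reflexive; ∸-monoˡ-≤; ^-monoʳ-≤; 1+n≰n)
open import Data.Bool using (Bool; true; false; _xor_)
open import Data.Bool.Properties using (xor-same)
open import Data.Vec using ([]; _∷_; tail)
open import Data.Fin using (Fin; combine)
import Data.Fin as Fin
open import Data.Fin.Properties using (2↔Bool; combine-injective; injective⇒≤)
open import Data.Fin.Subset using (Subset; ⊥; _∩_; ∣_∣)
open import Data.Fin.Subset.Properties using (∣⊥∣≡0)
open import Data.Product using (_,_)
open import Function.Base using (_∘_)
open import Function.Bundles using (Injection)
open import Function.Definitions using (Injective)
open import Function.Properties.Inverse using (↔⇒↣; ↔-sym)
open import Relation.Binary.PropositionalEquality using (_≡_; _≢_; refl; sym; cong; cong₂; subst)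
open import Relation.Nullary using (yes; no; contradiction)

private
  variable
    m n : ℕ

bit : Bool → Fin 2
bit = Injection.to (↔⇒↣ (↔-sym 2↔Bool))

bit-injective : Injective _≡_ _≡_ bit
bit-injective = Injection.injective (↔⇒↣ (↔-sym 2↔Bool))

toFin : Subset m → Fin (2 ^ m)
toFin []      = Fin.zero
toFin (b ∷ p) = combine (bit b) (toFin p)

toFin-injective : Injective _≡_ _≡_ (toFin {m})
toFin-injective {x = []}    {[]}    _  = refl
toFin-injective {suc m} {a ∷ p} {b ∷ q} eq
  with combine-injective (bit a) (toFin p) (bit b) (toFin q) eq
... | a≡b , p≡q = cong₂ _∷_ (bit-injective a≡b) (toFin-injective {m} p≡q)

-- The empty set takes the extra point of Fin (suc n), so the injection below
-- misses one of the 2 ^ m codes.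
nonempty-subsets-≤ : (f : Fin n → Subset m) → Injective _≡_ _≡_ f →
                     (∀ i → f i ≢ ⊥) → n ≤ 2 ^ m ∸ 1
nonempty-subsets-≤ {n} {m} f f-injective f≢⊥ = ∸-monoˡ-≤ 1 (injective⇒≤ g-injective)
  where
    g : Fin (suc n) → Fin (2 ^ m)
    g Fin.zero    = toFin (⊥ {m})
    g (Fin.suc i) = toFin (f i)

    g-injective : Injective _≡_ _≡_ g
    g-injective {Fin.zero}  {Fin.zero}  _  = refl
    g-injective {Fin.zero}  {Fin.suc j} eq = contradiction (sym (toFin-injective {m} eq)) (f≢⊥ j)
    g-injective {Fin.suc i} {Fin.zero}  eq = contradiction (toFin-injective {m} eq) (f≢⊥ i)
    g-injective {Fin.suc i} {Fin.suc j} eq = cong Fin.suc (f-injective (toFin-injective {m} eq))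

Δ-self : (p : Subset m) → p Δ p ≡ ⊥
Δ-self []      = refl
Δ-self (x ∷ p) = cong₂ _∷_ (xor-same x) (Δ-self p)

∣x∷⊥∣≤1 : ∀ x → ∣ x ∷ ⊥ {m} ∣ ≤ 1
∣x∷⊥∣≤1 {m} false = subst (_≤ 1) (sym (∣⊥∣≡0 m)) z≤n
∣x∷⊥∣≤1 {m} true  = s≤s (≤-reflexive (∣⊥∣≡0 m))

tail≡⊥⇒∣p∣≤1 : (p : Subset (suc m)) → tail p ≡ ⊥ → ∣ p ∣ ≤ 1
tail≡⊥⇒∣p∣≤1 {m} (x ∷ _) refl = ∣x∷⊥∣≤1 {m} x

tail≡⇒∣pΔq∣≤1 : (p q : Subset (suc m)) → tail p ≡ tail q → ∣ p Δ q ∣ ≤ 1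
tail≡⇒∣pΔq∣≤1 {m} (x ∷ p) (y ∷ .p) refl =
  subst (λ r → ∣ (x xor y) ∷ r ∣ ≤ 1) (sym (Δ-self p)) (∣x∷⊥∣≤1 {m} (x xor y))

redundant-family-≤ : (t : Fin n → Subset m) → (∀ i → 2 ≤ ∣ t i ∣) →
                     (∀ i j → i ≢ j → 2 ≤ ∣ t i Δ t j ∣) → n ≤ 2 ^ (m ∸ 1) ∸ 1
redundant-family-≤ {zero}  {_}     t large separated = z≤n
redundant-family-≤ {suc n} {zero}  t large separated with t Fin.zero | large Fin.zero
... | [] | ()
redundant-family-≤ {suc n} {suc m} t large separated =
  nonempty-subsets-≤ (tail ∘ t) injective
    (λ i eq → 1+n≰n (≤-trans (large i) (tail≡⊥⇒∣p∣≤1 (t i) eq)))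
  where
    injective : Injective _≡_ _≡_ (tail ∘ t)
    injective {i} {j} eq with i Fin.≟ j
    ... | yes i≡j = i≡j
    ... | no  i≢j = contradiction (≤-trans (separated i j i≢j) (tail≡⇒∣pΔq∣≤1 (t i) (t j) eq)) 1+n≰n

restrict : (S : Subset m) → Subset m → Subset ∣ S ∣
restrict []          []      = []
restrict (true ∷ S)  (a ∷ A) = a ∷ restrict S A
restrict (false ∷ S) (_ ∷ A) = restrict S A

∣restrict∣ : (S A : Subset m) → ∣ restrict S A ∣ ≡ ∣ A ∩ S ∣
∣restrict∣ []          []          = refl
∣restrict∣ (true ∷ S)  (true ∷ A)  = cong suc (∣restrict∣ S A)
∣restrict∣ (true ∷ S)  (false ∷ A) = ∣restrict∣ S A
∣restrict∣ (false ∷ S) (true ∷ A)  = ∣restrict∣ S A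
∣restrict∣ (false ∷ S) (false ∷ A) = ∣restrict∣ S A

∣restrict-Δ∣ : (S A B : Subset m) → ∣ restrict S A Δ restrict S B ∣ ≡ ∣ (A ∩ S) Δ (B ∩ S) ∣
∣restrict-Δ∣ []          []          []          = refl
∣restrict-Δ∣ (true ∷ S)  (true ∷ A)  (true ∷ B)  = ∣restrict-Δ∣ S A B
∣restrict-Δ∣ (true ∷ S)  (true ∷ A)  (false ∷ B) = cong suc (∣restrict-Δ∣ S A B)
∣restrict-Δ∣ (true ∷ S)  (false ∷ A) (true ∷ B)  = cong suc (∣restrict-Δ∣ S A B)
∣restrict-Δ∣ (true ∷ S)  (false ∷ A) (false ∷ B) = ∣restrict-Δ∣ S A B
∣restrict-Δ∣ (false ∷ S) (true ∷ A)  (true ∷ B)  = ∣restrict-Δ∣ S A B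
∣restrict-Δ∣ (false ∷ S) (true ∷ A)  (false ∷ B) = ∣restrict-Δ∣ S A B
∣restrict-Δ∣ (false ∷ S) (false ∷ A) (true ∷ B)  = ∣restrict-Δ∣ S A B
∣restrict-Δ∣ (false ∷ S) (false ∷ A) (false ∷ B) = ∣restrict-Δ∣ S A B

theorem5 : ∀ (n : ℕ) (G : SimpleGraph n) (k : ℕ) → 1 ≤ k → HasRedICAtMost G k → n ≤ 2 ^ (k ∸ 1) ∸ 1
theorem5 n G k _ (S , (cov , sep) , ∣S∣≤k) =
  ≤-trans (redundant-family-≤ trace trace-large trace-separated)
          (∸-monoˡ-≤ 1 (^-monoʳ-≤ 2 (∸-monoˡ-≤ 1 ∣S∣≤k)))
  where
    trace : Fin n → Subset ∣ S ∣
    trace v = restrict S (N[ v ] G)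

    trace-large : ∀ v → 2 ≤ ∣ trace v ∣
    trace-large v = subst (2 ≤_) (sym (∣restrict∣ S (N[ v ] G))) (cov v)

    trace-separated : ∀ u v → u ≢ v → 2 ≤ ∣ trace u Δ trace v ∣
    trace-separated u v u≢v =
      subst (2 ≤_) (sym (∣restrict-Δ∣ S (N[ u ] G) (N[ v ] G))) (sep u v u≢v)
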